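{- For every pair of integers $n \geq w \geq 1$, there exists a simple graph $G$ on $n$ nodes such that every $w$-cut sparsifier of $G$ has $\Omega(nw)$ edges.
   Context: All graphs are undirected. A \emph{sparsifier} of a graph $G$ is a graph $H$ obtained from $G$ by deleting edges and contracting subsets of the nodes (and removing any resulting self-loops); parallel edges are kept and counted separately when counting the edges of $H$. $H$ \emph{preserves} a cut $(S, V\setminus S)$ of $G$ if none of the edges of the cut is deleted and no two nodes from different sides of the cut are contracted together. $H$ is a \emph{$w$-cut sparsifier} of $G$ if it preserves every cut of $G$ that has at most $w$ edges. -}

module Defs where

open import Data.Nat using (ℕ; _≤_; _<_)
open import Data.Bool using (Bool; true; false; _∧_; _xor_; not)
open import Data.Fin using (Fin; toℕ) renaming (_≟_ to _≟ᶠ_)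
open import Data.Nat using () renaming (_<?_ to _<?ℕ_)
open import Data.List using (List; length; filterᵇ; concatMap)
open import Data.List using () renaming (allFin to allFinL)
open import Data.Product using (_×_; _,_)
open import Relation.Nullary.Decidable using (⌊_⌋)
open import Relation.Binary.PropositionalEquality using (_≡_; _≢_)

record SimpleGraph (n : ℕ) : Set where
  field
    adj    : Fin n → Fin n → Bool
    sym    : ∀ u v → adj u v ≡ adj v u
    irrefl : ∀ u → adj u u ≡ false
open SimpleGraph public

-- All unordered pairs {u,v}, represented as (u,v) with toℕ u < toℕ v.
pairs : (n : ℕ) → List (Fin n × Fin n)
pairs n = concatMap (λ u → concatMap (λ v → filterᵇ (λ p → lt p) ((u , v) Data.List.∷ Data.List.[])) (allFinL n)) (allFinL n)
  where
    lt : Fin n × Fin n → Bool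
    lt (u , v) = ⌊ toℕ u <?ℕ toℕ v ⌋

Cut : ℕ → Set
Cut n = Fin n → Bool

cutSize : ∀ {n} → SimpleGraph n → Cut n → ℕ
cutSize {n} G S = length (filterᵇ (λ { (u , v) → adj G u v ∧ (S u xor S v) }) (pairs n))

-- A sparsifier H of G: obtained by deleting edges and contracting node sets.
-- `keep u v` (read for toℕ u < toℕ v) says whether edge {u,v} is not deleted;
-- `cls` maps each node of G to the node of H it is contracted into (the
-- classes of the partition are the fibres of cls).
record Sparsifier (n : ℕ) : Set where
  field
    keep : Fin n → Fin n → Bool
    cls  : Fin n → Fin n
open Sparsifier public

-- Number of edges of H: kept edges of G whose endpoints lie in different
-- classes (self-loops removed, parallel edges counted separately).
edgesH : ∀ {n} → SimpleGraph n → Sparsifier n → ℕ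
edgesH {n} G H =
  length (filterᵇ (λ { (u , v) → adj G u v ∧ keep H u v ∧ not ⌊ cls H u ≟ᶠ cls H v ⌋ }) (pairs n))

Preserves : ∀ {n} → SimpleGraph n → Sparsifier n → Cut n → Set
Preserves G H S =
  (∀ u v → toℕ u < toℕ v → adj G u v ≡ true → S u ≢ S v → keep H u v ≡ true)
  × (∀ u v → cls H u ≡ cls H v → S u ≡ S v)

IsCutSparsifier : ∀ {n} → ℕ → SimpleGraph n → Sparsifier n → Set
IsCutSparsifier w G H = ∀ S → cutSize G S ≤ w → Preserves G H S

module Submission where

-- Take the band graph on 0 … n−1 joining x < y when gap ≤ y − x < gap + width, with
-- q = ⌊n/4⌋, gap = n − 2q and width = min(w, q).  Since 2·gap ≥ n, a node below gap has only
-- larger neighbours and a node from gap on only smaller ones, so every degree is at most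
-- width ≤ w.  Each singleton cut {u} therefore has at most w edges; a w-cut sparsifier
-- preserves it, so it deletes no edge at u and contracts u with no other node.  Hence it keeps
-- every edge of the band graph, and already the nodes x < q contribute q·width ≥ nw/49 edges.

open import Defs hiding (sym)
open import Data.Bool using (Bool; true; false; T; _∧_; _∨_; _xor_; not)
open import Data.Bool.Properties using (T-∧; T-≡; ∨-comm)
open import Data.Empty using (⊥-elim)
open import Data.Fin using (Fin; toℕ; zero; suc) renaming (_≟_ to _≟ᶠ_)
open import Data.List using (List; []; _∷_; _++_; length; filterᵇ; concatMap; map; tabulate; allFin)
open import Data.List.Properties using (filter-++; length-++; map-tabulate)
open import Data.List.Relation.Unary.All as All using (All; []; _∷_)
open import Data.List.Relation.Unary.All.Properties using (concat⁺; map⁺; tabulate⁺; all-filter)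
open import Data.Nat
open import Data.Nat.ListAction using (sum)
open import Data.Nat.Properties
open import Data.Nat.DivMod using (m≡m%n+[m/n]*n; m%n<n; m/n*n≤m; /-monoˡ-≤)
open import Data.Nat.Tactic.RingSolver using (solve-∀)
open import Algebra.Properties.CommutativeSemigroup +-commutativeSemigroup
  using () renaming (interchange to +-interchange)
open import Data.Product as Product using (Σ; _×_; _,_; proj₁; proj₂)
open import Data.Unit using (tt)
open import Function using (_∘_; Equivalence)
open import Relation.Nullary using (Dec; yes; no; ¬_; contradiction)
open import Relation.Nullary.Decidable using (⌊_⌋; _×-dec_; T?; toWitness; fromWitness; fromWitnessFalse; from-no)
open import Relation.Binary.PropositionalEquality

𝟙 : Bool → ℕ
𝟙 true  = 1
𝟙 false = 0

𝟙≤1 : ∀ b → 𝟙 b ≤ 1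
𝟙≤1 true  = ≤-refl
𝟙≤1 false = z≤n

𝟙-true : ∀ {b} → T b → 1 ≤ 𝟙 b
𝟙-true {true} _ = ≤-refl

𝟙-false : ∀ {b} → ¬ T b → 𝟙 b ≡ 0
𝟙-false {true}  ¬b = ⊥-elim (¬b tt)
𝟙-false {false} _  = refl

∑ : ℕ → (ℕ → ℕ) → ℕ
∑ zero    f = 0
∑ (suc n) f = f 0 + ∑ n (f ∘ suc)

count : ℕ → (ℕ → Bool) → ℕ
count n p = ∑ n (𝟙 ∘ p)

∑-cong : ∀ n {f g : ℕ → ℕ} → (∀ i → f i ≡ g i) → ∑ n f ≡ ∑ n g
∑-cong zero    f≗g = refl
∑-cong (suc n) f≗g = cong₂ _+_ (f≗g 0) (∑-cong n (f≗g ∘ suc))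

∑-mono : ∀ n {f g : ℕ → ℕ} → (∀ i → f i ≤ g i) → ∑ n f ≤ ∑ n g
∑-mono zero    f≤g = z≤n
∑-mono (suc n) f≤g = +-mono-≤ (f≤g 0) (∑-mono n (f≤g ∘ suc))

∑-+ : ∀ n (f g : ℕ → ℕ) → ∑ n (λ i → f i + g i) ≡ ∑ n f + ∑ n g
∑-+ zero    f g = refl
∑-+ (suc n) f g = begin
  f 0 + g 0 + ∑ n (λ i → f (suc i) + g (suc i))   ≡⟨ cong (f 0 + g 0 +_) (∑-+ n (f ∘ suc) (g ∘ suc)) ⟩
  f 0 + g 0 + (∑ n (f ∘ suc) + ∑ n (g ∘ suc))     ≡⟨ +-interchange (f 0) (g 0) _ _ ⟩
  f 0 + ∑ n (f ∘ suc) + (g 0 + ∑ n (g ∘ suc))     ∎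
  where open ≡-Reasoning

∑-*ˡ : ∀ n c (f : ℕ → ℕ) → ∑ n (λ i → c * f i) ≡ c * ∑ n f
∑-*ˡ zero    c f = sym (*-zeroʳ c)
∑-*ˡ (suc n) c f = trans (cong (c * f 0 +_) (∑-*ˡ n c (f ∘ suc))) (sym (*-distribˡ-+ c (f 0) _))

∑-lowerBound : ∀ r n {c} {f : ℕ → ℕ} → r ≤ n → (∀ i → i < r → c ≤ f i) → r * c ≤ ∑ n f
∑-lowerBound zero    n       _         _   = z≤n
∑-lowerBound (suc r) (suc n) (s≤s r≤n) c≤f =
  +-mono-≤ (c≤f 0 z<s) (∑-lowerBound r n r≤n (λ i i<r → c≤f (suc i) (s<s i<r)))

count-window≤ : ∀ n lo t {p : ℕ → Bool} →
  (∀ i → i < n → T (p i) → lo ≤ i × i < lo + t) → count n p ≤ t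
count-window≤ zero    lo       t       supp = z≤n
count-window≤ (suc n) (suc lo) t       supp =
  +-mono-≤ (≤-reflexive (𝟙-false (n≮0 ∘ proj₁ ∘ supp 0 z<s)))
           (count-window≤ n lo t λ i i<n pi → Product.map s≤s⁻¹ s≤s⁻¹ (supp (suc i) (s<s i<n) pi))
count-window≤ (suc n) zero     zero    supp =
  +-mono-≤ (≤-reflexive (𝟙-false (n≮0 ∘ proj₂ ∘ supp 0 z<s)))
           (count-window≤ n 0 0 λ i i<n pi → ⊥-elim (n≮0 (proj₂ (supp (suc i) (s<s i<n) pi))))
count-window≤ (suc n) zero     (suc t) supp =
  +-mono-≤ (𝟙≤1 _) (count-window≤ n 0 t λ i i<n pi → z≤n , s<s⁻¹ (proj₂ (supp (suc i) (s<s i<n) pi)))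

count-none : ∀ n {p : ℕ → Bool} → (∀ i → i < n → ¬ T (p i)) → count n p ≡ 0
count-none n none = n≤0⇒n≡0 (count-window≤ n 0 0 λ i i<n pi → ⊥-elim (none i i<n pi))

count-window≥ : ∀ n lo t {p : ℕ → Bool} →
  lo + t ≤ n → (∀ i → lo ≤ i → i < lo + t → T (p i)) → t ≤ count n p
count-window≥ n       zero     zero    _          _    = z≤n
count-window≥ (suc n) zero     (suc t) (s≤s t≤n) hits =
  +-mono-≤ (𝟙-true (hits 0 z≤n z<s)) (count-window≥ n 0 t t≤n λ i _ i<t → hits (suc i) z≤n (s<s i<t))
count-window≥ (suc n) (suc lo) t       (s≤s le)  hits =
  ≤-trans (count-window≥ n lo t le λ i lo≤i i<lo+t → hits (suc i) (s≤s lo≤i) (s<s i<lo+t)) (m≤n+m _ _)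

∑-select : ∀ n K (f : ℕ → ℕ) → ∑ n (λ x → 𝟙 ⌊ x ≟ K ⌋ * f x) ≤ f K
∑-select n K f = begin
  ∑ n (λ x → 𝟙 ⌊ x ≟ K ⌋ * f x)   ≡⟨ ∑-cong n at-K ⟩
  ∑ n (λ x → f K * 𝟙 ⌊ x ≟ K ⌋)   ≡⟨ ∑-*ˡ n (f K) _ ⟩
  f K * count n (λ x → ⌊ x ≟ K ⌋) ≤⟨ *-monoʳ-≤ (f K) (count-window≤ n K 1 only-K) ⟩
  f K * 1                          ≡⟨ *-identityʳ (f K) ⟩
  f K                              ∎
  where
  open ≤-Reasoning
  at-K : ∀ x → 𝟙 ⌊ x ≟ K ⌋ * f x ≡ f K * 𝟙 ⌊ x ≟ K ⌋
  at-K x with x ≟ K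
  ... | yes refl = *-comm 1 (f x)
  ... | no  _    = sym (*-zeroʳ (f K))
  only-K : ∀ x → x < n → T ⌊ x ≟ K ⌋ → K ≤ x × x < K + 1
  only-K x _ hit with refl ← toWitness hit = ≤-refl , m<m+n x z<s

length-filterᵇ-++ : ∀ {A : Set} (p : A → Bool) (xs ys : List A) →
  length (filterᵇ p (xs ++ ys)) ≡ length (filterᵇ p xs) + length (filterᵇ p ys)
length-filterᵇ-++ p xs ys = trans (cong length (filter-++ (T? ∘ p) xs ys)) (length-++ (filterᵇ p xs))

length-filterᵇ-concatMap : ∀ {A B : Set} (p : B → Bool) (f : A → List B) (xs : List A) →
  length (filterᵇ p (concatMap f xs)) ≡ sum (map (λ x → length (filterᵇ p (f x))) xs)
length-filterᵇ-concatMap p f []       = refl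
length-filterᵇ-concatMap p f (x ∷ xs) =
  trans (length-filterᵇ-++ p (f x) (concatMap f xs)) (cong (_ +_) (length-filterᵇ-concatMap p f xs))

length-filterᵇ-[_] : ∀ {A : Set} (x : A) (p q : A → Bool) →
  length (filterᵇ q (filterᵇ p (x ∷ []))) ≡ 𝟙 (p x ∧ q x)
length-filterᵇ-[ x ] p q with p x
... | false = refl
... | true with q x
...   | false = refl
...   | true  = refl

length-filterᵇ-mono : ∀ {A : Set} {p q : A → Bool} {xs : List A} →
  All (λ x → T (p x) → T (q x)) xs → length (filterᵇ p xs) ≤ length (filterᵇ q xs)
length-filterᵇ-mono []                         = z≤n
length-filterᵇ-mono {p = p} {q} (_∷_ {x} p⇒q rest) with p x | q x | p⇒q
... | true  | true  | _    = s≤s (length-filterᵇ-mono rest)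
... | true  | false | p⇒q′ = ⊥-elim (p⇒q′ tt)
... | false | true  | _    = m≤n⇒m≤1+n (length-filterᵇ-mono rest)
... | false | false | _    = length-filterᵇ-mono rest

sum-tabulate : ∀ n (f : Fin n → ℕ) (g : ℕ → ℕ) → (∀ i → f i ≡ g (toℕ i)) → sum (tabulate f) ≡ ∑ n g
sum-tabulate zero    f g f≗g = refl
sum-tabulate (suc n) f g f≗g = cong₂ _+_ (f≗g zero) (sum-tabulate n (f ∘ suc) (g ∘ suc) (f≗g ∘ suc))

sum-map-allFin : ∀ n (f : Fin n → ℕ) (g : ℕ → ℕ) → (∀ i → f i ≡ g (toℕ i)) → sum (map f (allFin n)) ≡ ∑ n g
sum-map-allFin n f g f≗g = trans (cong sum (map-tabulate {n = n} (λ i → i) f)) (sum-tabulate n f g f≗g)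

ascending : ∀ {n} → Fin n × Fin n → Bool
ascending (u , v) = ⌊ toℕ u <? toℕ v ⌋

pairs-count : ∀ n (P : ℕ → ℕ → Bool) →
  length (filterᵇ (λ uv → P (toℕ (proj₁ uv)) (toℕ (proj₂ uv))) (pairs n))
    ≡ ∑ n (λ x → ∑ n (λ y → 𝟙 (⌊ x <? y ⌋ ∧ P x y)))
pairs-count n P =
  trans (length-filterᵇ-concatMap _ _ (allFin n)) (sum-map-allFin n _ _ λ u →
  trans (length-filterᵇ-concatMap _ _ (allFin n)) (sum-map-allFin n _ _ λ v →
  length-filterᵇ-[ u , v ] ascending (λ uv → P (toℕ (proj₁ uv)) (toℕ (proj₂ uv)))))

pairs-ascending : ∀ n → All (λ uv → toℕ (proj₁ uv) < toℕ (proj₂ uv)) (pairs n)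
pairs-ascending n = concat⁺ (map⁺ (tabulate⁺ λ u → concat⁺ (map⁺ (tabulate⁺ λ v →
  All.map toWitness (all-filter (T? ∘ ascending) ((u , v) ∷ []))))))

singletonCut : ∀ {n} → Fin n → Cut n
singletonCut k u = ⌊ toℕ u ≟ toℕ k ⌋

edgeCount : ∀ {n} → SimpleGraph n → ℕ
edgeCount {n} G = length (filterᵇ (λ uv → adj G (proj₁ uv) (proj₂ uv)) (pairs n))

edgeCount≤edgesH : ∀ {n w} (G : SimpleGraph n) (H : Sparsifier n) →
  (∀ k → cutSize G (singletonCut k) ≤ w) → IsCutSparsifier w G H → edgeCount G ≤ edgesH G H
edgeCount≤edgesH {n} G H degree≤w sparsifier = length-filterᵇ-mono (All.map survives (pairs-ascending n))
  where
  survives : ∀ {uv} → toℕ (proj₁ uv) < toℕ (proj₂ uv) → T (adj G (proj₁ uv) (proj₂ uv)) →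
    T (adj G (proj₁ uv) (proj₂ uv) ∧ keep H (proj₁ uv) (proj₂ uv) ∧ not ⌊ cls H (proj₁ uv) ≟ᶠ cls H (proj₂ uv) ⌋)
  survives {u , v} u<v uv = from T-∧ (uv , from T-∧ (kept , uncontracted))
    where
    open Equivalence
    separated : singletonCut u u ≢ singletonCut u v
    separated same = <-irrefl (sym (toWitness (subst T same (fromWitness refl)))) u<v
    preserved : Preserves G H (singletonCut u)
    preserved = sparsifier (singletonCut u) (degree≤w u)
    kept : T (keep H u v)
    kept = from T-≡ (proj₁ preserved u v u<v (to T-≡ uv) separated)
    uncontracted : T (not ⌊ cls H u ≟ᶠ cls H v ⌋)
    uncontracted = fromWitnessFalse (separated ∘ proj₂ preserved u v)

module Oriented (arc : ℕ → ℕ → Bool) (arc-< : ∀ {x y} → T (arc x y) → x < y) where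

  arc-irrefl : ∀ x → arc x x ≡ false
  arc-irrefl x with arc x x | arc-< {x} {x}
  ... | true  | x<x = ⊥-elim (<-irrefl refl (x<x tt))
  ... | false | _   = refl

  orientedGraph : ∀ n → SimpleGraph n
  orientedGraph n = record
    { adj    = λ u v → arc (toℕ u) (toℕ v) ∨ arc (toℕ v) (toℕ u)
    ; sym    = λ u v → ∨-comm (arc (toℕ u) (toℕ v)) (arc (toℕ v) (toℕ u))
    ; irrefl = λ u → cong₂ _∨_ (arc-irrefl (toℕ u)) (arc-irrefl (toℕ u))
    }

  outDegree : ℕ → ℕ → ℕ
  outDegree n x = count n (arc x)

  inDegree : ℕ → ℕ → ℕ
  inDegree n y = count n (λ x → arc x y)

  cutTerm≤ : ∀ K x y →
    𝟙 (⌊ x <? y ⌋ ∧ ((arc x y ∨ arc y x) ∧ (⌊ x ≟ K ⌋ xor ⌊ y ≟ K ⌋)))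
      ≤ 𝟙 ⌊ x ≟ K ⌋ * 𝟙 (arc x y) + 𝟙 ⌊ y ≟ K ⌋ * 𝟙 (arc x y)
  cutTerm≤ K x y with x <? y
  ... | no  _   = z≤n
  ... | yes x<y with arc y x | arc-< {y} {x}
  ...   | true  | y<x = ⊥-elim (<-asym x<y (y<x tt))
  ...   | false | _   with arc x y
  ...     | false = z≤n
  ...     | true  with x ≟ K | y ≟ K
  ...       | yes _ | yes _ = z≤n
  ...       | yes _ | no  _ = ≤-refl
  ...       | no  _ | yes _ = ≤-refl
  ...       | no  _ | no  _ = z≤n

  singletonCut≤ : ∀ n (k : Fin n) →
    cutSize (orientedGraph n) (singletonCut k) ≤ outDegree n (toℕ k) + inDegree n (toℕ k)
  singletonCut≤ n k = begin
    cutSize (orientedGraph n) (singletonCut k)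
      ≡⟨ pairs-count n _ ⟩
    ∑ n (λ x → ∑ n (crossing x))
      ≤⟨ ∑-mono n (λ x → ∑-mono n (cutTerm≤ K x)) ⟩
    ∑ n (λ x → ∑ n (λ y → leaving x y + entering x y))
      ≡⟨ trans (∑-cong n λ x → ∑-+ n (leaving x) (entering x)) (∑-+ n _ _) ⟩
    ∑ n (λ x → ∑ n (leaving x)) + ∑ n (λ x → ∑ n (entering x))
      ≡⟨ cong₂ _+_ (∑-cong n λ x → ∑-*ˡ n (𝟙 ⌊ x ≟ K ⌋) (𝟙 ∘ arc x)) refl ⟩
    ∑ n (λ x → 𝟙 ⌊ x ≟ K ⌋ * outDegree n x) + ∑ n (λ x → ∑ n (entering x))
      ≤⟨ +-mono-≤ (∑-select n K (outDegree n)) (∑-mono n λ x → ∑-select n K (𝟙 ∘ arc x)) ⟩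
    outDegree n K + inDegree n K
      ∎
    where
    open ≤-Reasoning
    K : ℕ
    K = toℕ k
    crossing leaving entering : ℕ → ℕ → ℕ
    crossing x y = 𝟙 (⌊ x <? y ⌋ ∧ ((arc x y ∨ arc y x) ∧ (⌊ x ≟ K ⌋ xor ⌊ y ≟ K ⌋)))
    leaving  x y = 𝟙 ⌊ x ≟ K ⌋ * 𝟙 (arc x y)
    entering x y = 𝟙 ⌊ y ≟ K ⌋ * 𝟙 (arc x y)

  edgeTerm≥ : ∀ x y → 𝟙 (arc x y) ≤ 𝟙 (⌊ x <? y ⌋ ∧ (arc x y ∨ arc y x))
  edgeTerm≥ x y with arc x y | arc-< {x} {y}
  ... | false | _   = z≤n
  ... | true  | x<y with x <? y
  ...   | yes _   = ≤-refl
  ...   | no  x≮y = ⊥-elim (x≮y (x<y tt))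

  ∑-outDegree≤edgeCount : ∀ n → ∑ n (outDegree n) ≤ edgeCount (orientedGraph n)
  ∑-outDegree≤edgeCount n = begin
    ∑ n (outDegree n)                                                ≤⟨ ∑-mono n (λ x → ∑-mono n (edgeTerm≥ x)) ⟩
    ∑ n (λ x → ∑ n (λ y → 𝟙 (⌊ x <? y ⌋ ∧ (arc x y ∨ arc y x))))     ≡⟨ pairs-count n _ ⟨
    edgeCount (orientedGraph n)                                      ∎
    where open ≤-Reasoning

module Band (gap width : ℕ) where

  -- The conjunct x < y only matters for gap = 0, where it keeps the graph loopless.
  Arc : ℕ → ℕ → Set
  Arc x y = x < y × x + gap ≤ y × y < x + gap + width

  arc? : ∀ x y → Dec (Arc x y)
  arc? x y = x <? y ×-dec x + gap ≤? y ×-dec y <? x + gap + width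

  open Oriented (λ x y → ⌊ arc? x y ⌋) (proj₁ ∘ toWitness) public

  band : ∀ n → SimpleGraph n
  band = orientedGraph

  outDegree≤width : ∀ n x → outDegree n x ≤ width
  outDegree≤width n x = count-window≤ n (x + gap) width λ y _ hit → proj₂ (toWitness hit)

  inDegree≤width : ∀ n y → inDegree n y ≤ width
  inDegree≤width n y = count-window≤ n lo width window
    where
    lo : ℕ
    lo = suc y ∸ (gap + width)
    rotate : ∀ a b c → a + b + c ≡ b + c + a
    rotate = solve-∀
    window : ∀ x → x < n → T ⌊ arc? x y ⌋ → lo ≤ x × x < lo + width
    window x _ hit with _ , x+gap≤y , y<x+gap+width ← toWitness hit = lo≤x , x<lo+width
      where
      open ≤-Reasoning
      lo≤x : lo ≤ x
      lo≤x = m≤n+o⇒m∸n≤o (suc y) (gap + width) (begin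
        suc y             ≤⟨ y<x+gap+width ⟩
        x + gap + width   ≡⟨ rotate x gap width ⟩
        gap + width + x   ∎)
      x<lo+width : x < lo + width
      x<lo+width = +-cancelʳ-< gap x (lo + width) (begin-strict
        x + gap           ≤⟨ x+gap≤y ⟩
        y                 <⟨ n<1+n y ⟩
        suc y             ≤⟨ m≤n+m∸n (suc y) (gap + width) ⟩
        gap + width + lo  ≡⟨ rotate gap width lo ⟩
        width + lo + gap  ≡⟨ cong (_+ gap) (+-comm width lo) ⟩
        lo + width + gap  ∎)

  outDegree≡0 : ∀ n x → n ≤ x + gap → outDegree n x ≡ 0
  outDegree≡0 n x n≤x+gap = count-none n λ y y<n hit → <⇒≱ y<n (≤-trans n≤x+gap (proj₁ (proj₂ (toWitness hit))))

  inDegree≡0 : ∀ n y → y < gap → inDegree n y ≡ 0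
  inDegree≡0 n y y<gap = count-none n λ x _ hit → <⇒≱ y<gap (≤-trans (m≤n+m gap x) (proj₁ (proj₂ (toWitness hit))))

  width≤outDegree : ∀ n x → 1 ≤ gap → x + gap + width ≤ n → width ≤ outDegree n x
  width≤outDegree n x 1≤gap fits = count-window≥ n (x + gap) width fits λ y x+gap≤y y<x+gap+width →
    fromWitness (<-≤-trans (m<m+n x 1≤gap) x+gap≤y , x+gap≤y , y<x+gap+width)

  band-degree≤width : ∀ n → n ≤ gap + gap → (k : Fin n) → cutSize (band n) (singletonCut k) ≤ width
  band-degree≤width n n≤2gap k = ≤-trans (singletonCut≤ n k) (oneSided (K <? gap))
    where
    K : ℕ
    K = toℕ k
    oneSided : Dec (K < gap) → outDegree n K + inDegree n K ≤ width
    oneSided (yes K<gap) rewrite inDegree≡0 n K K<gap = ≤-trans (≤-reflexive (+-identityʳ _)) (outDegree≤width n K)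
    oneSided (no  K≮gap) rewrite outDegree≡0 n K (≤-trans n≤2gap (+-monoˡ-≤ gap (≮⇒≥ K≮gap))) = inDegree≤width n K

  band-edgeCount≥ : ∀ n r → 1 ≤ gap → r + gap + width ≤ n → r * width ≤ edgeCount (band n)
  band-edgeCount≥ n r 1≤gap fits =
    ≤-trans (∑-lowerBound r n (≤-trans (≤-trans (m≤m+n r gap) (m≤m+n (r + gap) width)) fits) long)
            (∑-outDegree≤edgeCount n)
    where
    long : ∀ x → x < r → width ≤ outDegree n x
    long x x<r = width≤outDegree n x 1≤gap (≤-trans (+-monoˡ-≤ width (+-monoˡ-≤ gap (<⇒≤ x<r))) fits)

16≤n*w⇒4≤n : ∀ {n w} → w ≤ n → 16 ≤ n * w → 4 ≤ n
16≤n*w⇒4≤n {n} {w} w≤n 16≤nw with 4 ≤? n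
... | yes 4≤n = 4≤n
... | no  4≰n = contradiction (≤-trans 16≤nw (*-mono-≤ n≤3 (≤-trans w≤n n≤3))) (from-no (16 ≤? 9))
  where
  n≤3 : n ≤ 3
  n≤3 = s≤s⁻¹ (≰⇒> 4≰n)

n≤7*[n/4] : ∀ n → 4 ≤ n → n ≤ 7 * (n / 4)
n≤7*[n/4] n 4≤n = begin
  n                        ≡⟨ m≡m%n+[m/n]*n n 4 ⟩
  n % 4 + n / 4 * 4        ≤⟨ +-monoˡ-≤ (n / 4 * 4) (s≤s⁻¹ (m%n<n n 4)) ⟩
  3 + n / 4 * 4            ≤⟨ +-monoˡ-≤ (n / 4 * 4) (*-monoʳ-≤ 3 (/-monoˡ-≤ 4 4≤n)) ⟩
  3 * (n / 4) + n / 4 * 4  ≡⟨ cong (3 * (n / 4) +_) (*-comm (n / 4) 4) ⟩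
  3 * (n / 4) + 4 * (n / 4) ≡⟨ *-distribʳ-+ (n / 4) 3 4 ⟨
  7 * (n / 4)              ∎
  where open ≤-Reasoning

4*[n/4]≤n : ∀ n → n / 4 + n / 4 + (n / 4 + n / 4) ≤ n
4*[n/4]≤n n = ≤-trans (≤-reflexive (four-times (n / 4))) (m/n*n≤m n 4)
  where
  four-times : ∀ q → q + q + (q + q) ≡ q * 4
  four-times = solve-∀

module QuarterSplit (n q : ℕ) (4q≤n : q + q + (q + q) ≤ n) where

  rest : ℕ
  rest = n ∸ (q + q)

  2q≤rest : q + q ≤ rest
  2q≤rest = begin
    q + q                     ≡⟨ m+n∸n≡m (q + q) (q + q) ⟨
    q + q + (q + q) ∸ (q + q) ≤⟨ ∸-monoˡ-≤ (q + q) 4q≤n ⟩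
    rest                      ∎
    where open ≤-Reasoning

  rest+2q≡n : rest + (q + q) ≡ n
  rest+2q≡n = m∸n+n≡m (≤-trans (m≤n+m (q + q) (q + q)) 4q≤n)

  n≤rest+rest : n ≤ rest + rest
  n≤rest+rest = ≤-trans (≤-reflexive (sym rest+2q≡n)) (+-monoʳ-≤ rest 2q≤rest)

  q+rest+q≡n : q + rest + q ≡ n
  q+rest+q≡n = trans (+-comm (q + rest) q) (trans (sym (+-assoc q q rest)) (trans (+-comm (q + q) rest) rest+2q≡n))

n*w≤49*q*[w⊓q] : ∀ {n w} q → n ≤ 7 * q → w ≤ n → n * w ≤ 49 * (q * (w ⊓ q))
n*w≤49*q*[w⊓q] {n} {w} q n≤7q w≤n = begin
  n * w                   ≤⟨ *-mono-≤ n≤7q w≤7t ⟩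
  7 * q * (7 * (w ⊓ q))   ≡⟨ regroup q (w ⊓ q) ⟩
  49 * (q * (w ⊓ q))      ∎
  where
  open ≤-Reasoning
  w≤7t : w ≤ 7 * (w ⊓ q)
  w≤7t = ≤-trans (⊓-glb (m≤n*m w 7) (≤-trans w≤n n≤7q)) (≤-reflexive (sym (*-distribˡ-⊓ 7 w q)))
  regroup : ∀ a b → 7 * a * (7 * b) ≡ 49 * (a * b)
  regroup = solve-∀

mainTheorem1 : Σ ℕ λ c → Σ ℕ λ n₀ → 1 ≤ c ×
    ((n w : ℕ) → 1 ≤ w → w ≤ n → n₀ ≤ n * w →
      Σ (SimpleGraph n) λ G →
        (H : Sparsifier n) → IsCutSparsifier w G H → n * w ≤ c * edgesH G H)
mainTheorem1 = 49 , 16 , s≤s z≤n , construction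
  where
  construction : (n w : ℕ) → 1 ≤ w → w ≤ n → 16 ≤ n * w →
    Σ (SimpleGraph n) λ G → (H : Sparsifier n) → IsCutSparsifier w G H → n * w ≤ 49 * edgesH G H
  construction n w _ w≤n 16≤nw = band n , λ H sparsifier → begin
    n * w                    ≤⟨ n*w≤49*q*[w⊓q] q (n≤7*[n/4] n 4≤n) w≤n ⟩
    49 * (q * (w ⊓ q))       ≤⟨ *-monoʳ-≤ 49 (band-edgeCount≥ n q 1≤rest q+rest+width≤n) ⟩
    49 * edgeCount (band n)  ≤⟨ *-monoʳ-≤ 49 (edgeCount≤edgesH (band n) H degree≤w sparsifier) ⟩
    49 * edgesH (band n) H   ∎
    where
    open ≤-Reasoning
    4≤n : 4 ≤ n
    4≤n = 16≤n*w⇒4≤n w≤n 16≤nw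
    q : ℕ
    q = n / 4
    open QuarterSplit n q (4*[n/4]≤n n)
    open Band rest (w ⊓ q)
    1≤rest : 1 ≤ rest
    1≤rest = ≤-trans (≤-trans (/-monoˡ-≤ 4 4≤n) (m≤m+n q q)) 2q≤rest
    q+rest+width≤n : q + rest + w ⊓ q ≤ n
    q+rest+width≤n = ≤-trans (+-monoʳ-≤ (q + rest) (m⊓n≤n w q)) (≤-reflexive q+rest+q≡n)
    degree≤w : ∀ k → cutSize (band n) (singletonCut k) ≤ w
    degree≤w k = ≤-trans (band-degree≤width n n≤rest+rest k) (m⊓n≤m w q)
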